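{- Let $\sigma$ be a modal signature and $M_a$ a degree-finite $\sigma$-LTS. Then (i) if $T_c\in\mathcal{A}_\sigma$, then $\hom_{\mathbb{N}}(T_c,M_a)=\hom_{\mathbb{N}}(T^\downarrow_c,M^B_a)$; and (ii) if $T_c\in\mathcal{T}_{\sigma_B}$, then $\hom_{\mathbb{N}}(T_c,M^B_a)=\hom_{\mathbb{N}}(\mathrm{flip}(T_c),M_a)$.
   Context: A modal signature is $\sigma = \mathrm{Prop} \cup \mathbb{A}$, where $\mathrm{Prop}$ is a finite set of unary relation symbols (proposition letters) and $\mathbb{A} = \{R_i \mid i \in I\}$ ($I$ finite) is a finite set of binary relation symbols (actions). $\sigma_B=\mathrm{Prop}\cup\mathbb{A}\cup\{B_i\mid i\in I\}$ with fresh binary symbols $B_i$. A $\sigma$-LTS $M_a$ is a (possibly infinite) $\sigma$-structure with one distinguished element $a$; it is degree-finite if every state has finitely many successors and predecessors along actions. A homomorphism $h:T_c\to M_a$ is a map with $h(c)=a$ preserving all unary and binary facts; $\hom_{\mathbb{N}}(T_c,M_a)$ is the number of them. The backward expansion $M^B_a$ of a $\sigma$-LTS $M_a$ is the $\sigma_B$-expansion with $B_i^{M^B}=\{(n,m)\mid R_i^M(m,n)\}$. The underlying graph of a structure has one undirected edge $\{m,n\}$ per binary fact on $m,n$; connected and acyclic (no cycles, including loops and parallel edges from distinct facts) refer to this graph; for connected $T_c$ the depth of a state is its distance from $c$ in the underlying graph. $\mathcal{A}_\sigma$ is the class of finite connected acyclic $\sigma$-LTSs. For $T_c\in\mathcal{A}_\sigma$,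 $T^\downarrow_c$ is the $\sigma_B$-LTS with the same domain, propositions and distinguished element in which $R_i^{T^\downarrow}(m,n)$ holds whenever $R_i^T(m,n)$ with $\mathrm{depth}(m)<\mathrm{depth}(n)$, and $B_i^{T^\downarrow}(m,n)$ holds whenever $R_i^T(n,m)$ with $\mathrm{depth}(n)>\mathrm{depth}(m)$ (i.e., edges pointing toward the root are reversed and relabeled $B_i$), and no other binary facts. A directed path uses binary facts of the signature in the forward direction; a $\sigma_B$-tree is a $\sigma_B$-LTS in which every state is reached from the distinguished element by a unique directed $\sigma_B$-path, and $\mathcal{T}_{\sigma_B}$ is the class of finite $\sigma_B$-trees. For a $\sigma_B$-LTS $S_d$, $\mathrm{flip}(S_d)$ is the $\sigma$-LTS with the same domain, propositions and distinguished element and $R_i^{\mathrm{flip}(S)}=R_i^S\cup(B_i^S)^{ -1}$. -}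

module Defs where

open import Data.Nat using (ℕ; zero; suc; _<_; _≤_)
open import Data.Fin using (Fin)
open import Data.Bool using (Bool; true)
open import Data.Sum using (_⊎_; inj₁; inj₂)
open import Data.Product using (Σ; ∃; _×_; _,_; proj₁)
open import Data.List using (List; []; _∷_; length)
open import Data.List.Membership.Propositional using (_∈_)
open import Data.List.Relation.Unary.Unique.Propositional using (Unique)
open import Relation.Binary.PropositionalEquality using (_≡_)
open import Relation.Nullary using (¬_)

-- Structures are parameterised by the
-- index type A of their binary symbols:  A = Fin nA for σ and
-- A = Fin nA ⊎ Fin nA for σ_B  (inj₁ i ↦ R_i, inj₂ i ↦ B_i).

record Struct (nP : ℕ) (A : Set) : Set₁ where
  field
    St   : Set
    prop : Fin nP → St → Set
    rel  : A → St → St → Set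
    root : St
open Struct public

σB : ℕ → Set
σB nA = Fin nA ⊎ Fin nA

DegreeFinite : ∀ {nP nA} → Struct nP (Fin nA) → Set
DegreeFinite M =
  ∀ (i : Fin _) (s : St M) →
    (∃ λ (L : List (St M)) → ∀ t → rel M i s t → t ∈ L) ×
    (∃ λ (L : List (St M)) → ∀ t → rel M i t s → t ∈ L)

record Hom {nP : ℕ} {A : Set} (S M : Struct nP A) : Set where
  field
    map       : St S → St M
    map-root  : map (root S) ≡ root M
    map-prop  : ∀ p x → prop S p x → prop M p (map x)
    map-rel   : ∀ a x y → rel S a x y → rel M a (map x) (map y)
open Hom public

SameHom : ∀ {nP A} {S M : Struct nP A} → Hom S M → Hom S M → Set
SameHom {S = S} h g = ∀ x → map h x ≡ map g x

-- HomCount S M n : hom_ℕ(S, M) = n, i.e. there is a bijection between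
-- Fin n and the set of homomorphisms S → M.
HomCount : ∀ {nP A} (S M : Struct nP A) → ℕ → Set
HomCount S M n =
  Σ (Fin n → Hom S M) λ f →
    (∀ j j′ → SameHom (f j) (f j′) → j ≡ j′) ×
    (∀ h → ∃ λ j → SameHom (f j) h)

backExp : ∀ {nP nA} → Struct nP (Fin nA) → Struct nP (σB nA)
backExp M = record
  { St = St M ; prop = prop M ; root = root M
  ; rel = λ { (inj₁ i) m n → rel M i m n ; (inj₂ i) m n → rel M i n m } }

record FinStruct (nP : ℕ) (A : Set) : Set where
  field
    size  : ℕ
    fprop : Fin nP → Fin size → Bool
    frel  : A → Fin size → Fin size → Bool
    froot : Fin size
open FinStruct public

⟦_⟧ : ∀ {nP A} → FinStruct nP A → Struct nP A
⟦ T ⟧ = record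
  { St = Fin (size T)
  ; prop = λ p x → fprop T p x ≡ true
  ; rel = λ a x y → frel T a x y ≡ true
  ; root = froot T }

module _ {nP : ℕ} {A : Set} (T : FinStruct nP A) where

  Fact : Set
  Fact = A × Fin (size T) × Fin (size T)

  data Walk : Fin (size T) → Fin (size T) → Set where
    []  : ∀ {u} → Walk u u
    fwd : ∀ {u w v} (a : A) → frel T a u w ≡ true → Walk w v → Walk u v
    bwd : ∀ {u w v} (a : A) → frel T a w u ≡ true → Walk w v → Walk u v

  walkLength : ∀ {u v} → Walk u v → ℕ
  walkLength []          = zero
  walkLength (fwd _ _ w) = suc (walkLength w)
  walkLength (bwd _ _ w) = suc (walkLength w)

  walkFacts : ∀ {u v} → Walk u v → List Fact
  walkFacts []                  = []
  walkFacts (fwd {u} {w} a _ p) = (a , u , w) ∷ walkFacts p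
  walkFacts (bwd {u} {w} a _ p) = (a , w , u) ∷ walkFacts p

  walkVerts : ∀ {u v} → Walk u v → List (Fin (size T))
  walkVerts []              = []
  walkVerts (fwd {u} _ _ p) = u ∷ walkVerts p
  walkVerts (bwd {u} _ _ p) = u ∷ walkVerts p

  -- a cycle: closed walk of length ≥ 1 with pairwise distinct facts and
  -- no repeated vertex (apart from start = end).  Loops and parallel
  -- edges from distinct facts are cycles.
  Cycle : Set
  Cycle = Σ (Fin (size T)) λ u → Σ (Walk u u) λ w →
            (1 ≤ walkLength w) × Unique (walkFacts w) × Unique (walkVerts w)

  Connected : Set
  Connected = ∀ v → Walk (froot T) v

  Acyclic : Set
  Acyclic = ¬ Cycle

  Depth : Fin (size T) → ℕ → Set
  Depth v d = Σ (Walk (froot T) v) (λ w → walkLength w ≡ d) ×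
              (∀ (w : Walk (froot T) v) → d ≤ walkLength w)

  Shallower : Fin (size T) → Fin (size T) → Set
  Shallower m n = ∃ λ dm → ∃ λ dn → Depth m dm × Depth n dn × dm < dn

  data DPath : Fin (size T) → Fin (size T) → Set where
    []   : ∀ {u} → DPath u u
    step : ∀ {u w v} (a : A) → frel T a u w ≡ true → DPath w v → DPath u v

  dtrace : ∀ {u v} → DPath u v → List (A × Fin (size T))
  dtrace []                  = []
  dtrace (step {w = w} a _ p) = (a , w) ∷ dtrace p

  IsTree : Set
  IsTree = ∀ v → DPath (froot T) v ×
                 (∀ (p q : DPath (froot T) v) → dtrace p ≡ dtrace q)

InA : ∀ {nP nA} → FinStruct nP (Fin nA) → Set
InA T = Connected T × Acyclic T

down : ∀ {nP nA} → FinStruct nP (Fin nA) → Struct nP (σB nA)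
down T = record
  { St = Fin (size T)
  ; prop = λ p x → fprop T p x ≡ true
  ; root = froot T
  ; rel = λ { (inj₁ i) m n → frel T i m n ≡ true × Shallower T m n
            ; (inj₂ i) m n → frel T i n m ≡ true × Shallower T m n } }

flip : ∀ {nP nA} → FinStruct nP (σB nA) → Struct nP (Fin nA)
flip S = record
  { St = Fin (size S)
  ; prop = λ p x → fprop S p x ≡ true
  ; root = froot S
  ; rel = λ i m n → (frel S (inj₁ i) m n ≡ true) ⊎ (frel S (inj₂ i) n m ≡ true) }

-- A map is a homomorphism T → M iff it is a homomorphism T↓ → M^B, and a
-- homomorphism T → M^B iff it is one flip(T) → M: each fact of the source on
-- one side is a fact of the source on the other side, kept or reversed and
-- relabelled, and reversing is undone by the backward expansion.  So in both
-- parts the two counts count the same maps.  For (i) this needs every edge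
-- of T to join states of different depth.  An edge between two states of
-- depth d closes a walk of odd length 2d + 1 through the root, and an odd
-- closed walk always contains a cycle: one that is not a cycle repeats a
-- vertex or a fact, and cutting it there leaves two shorter closed walks, one
-- of which is odd.
module Submission where

open import Defs
open import Data.Nat using (ℕ; suc; zero; _+_; _<_; _≤_; z≤n; s≤s; s≤s⁻¹)
open import Data.Nat.Properties
  using (+-suc; +-identityʳ; +-comm; ≮⇒≥; m≤n⇒m<n∨m≡n; m≤m+n; m≤n+m; m<m+n; m<n+m; n≤1+n; ≤-trans; <-cmp; suc-injective)
open import Data.Nat.Induction using (<-wellFounded)
open import Data.Nat.Tactic.RingSolver using (solve-∀)
open import Data.Fin using (Fin; _≟_)
open import Data.Fin.Properties using (any?)
open import Data.Bool using (true)
import Data.Bool.Properties as Bool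
open import Data.Empty using (⊥; ⊥-elim)
open import Data.Unit using (⊤; tt)
open import Data.Sum using (_⊎_; inj₁; inj₂)
open import Data.Product using (Σ; ∃; _×_; _,_)
open import Data.Product.Properties using (≡-dec)
open import Data.List using (List; []; _∷_; _++_)
open import Data.List.Properties using (∷-injectiveˡ; ∷-injectiveʳ)
open import Data.List.Membership.Propositional.Properties using (∈-∃++)
open import Data.List.Membership.DecPropositional using (_∈?_)
open import Data.List.Relation.Unary.All.Properties.Core using (¬Any⇒All¬)
open import Data.List.Relation.Unary.Unique.Propositional using (Unique)
open import Data.List.Relation.Unary.AllPairs using ([]; _∷_)
open import Function.Base using (id)
open import Function.Bundles using (_⇔_; mk⇔; Inverse; Injection)
open import Function.Properties.Inverse using (Inverse⇒Injection)
import Function.Construct.Symmetry as Symmetry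
open import Induction.WellFounded using (Acc; acc)
open import Relation.Binary.Bundles using (Setoid)
open import Relation.Binary.Definitions using (DecidableEquality; tri<; tri≈; tri>)
open import Relation.Binary.PropositionalEquality using (_≡_; refl; sym; trans; cong; cong₂; subst; module ≡-Reasoning)
open import Relation.Nullary using (¬_; Dec; yes; no)
open import Relation.Nullary.Decidable using (_×-dec_; _⊎-dec_)
open import Relation.Unary using (Decidable)

homSetoid : ∀ {nP A} (S M : Struct nP A) → Setoid _ _
homSetoid S M = record
  { Carrier = Hom S M
  ; _≈_ = SameHom
  ; isEquivalence = record
    { refl = λ _ → refl
    ; sym = λ h≈g x → sym (h≈g x)
    ; trans = λ h≈g g≈k x → trans (h≈g x) (g≈k x) } }

homCount-transfer : ∀ {nP A A′} {S M : Struct nP A} {S′ M′ : Struct nP A′} {n} →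
  Inverse (homSetoid S M) (homSetoid S′ M′) → HomCount S M n → HomCount S′ M′ n
homCount-transfer I (f , f-injective , f-onto) =
    (λ j → to (f j))
  , (λ j j′ same → f-injective j j′ (Injection.injective (Inverse⇒Injection I) same))
  , λ h → let (j , same) = f-onto (from h) in j , λ x → trans (to-cong same x) (strictlyInverseˡ h x)
  where open Inverse I

homCount-⇔ : ∀ {nP A A′} {S M : Struct nP A} {S′ M′ : Struct nP A′} {n} →
  Inverse (homSetoid S M) (homSetoid S′ M′) → HomCount S M n ⇔ HomCount S′ M′ n
homCount-⇔ I = mk⇔ (homCount-transfer I) (homCount-transfer (Symmetry.inverse I))

Odd : ℕ → Set
Odd zero = ⊥
Odd (suc zero) = ⊤
Odd (suc (suc n)) = Odd n

Odd-+ : ∀ m {n} → Odd (m + n) → Odd m ⊎ Odd n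
Odd-+ zero odd = inj₂ odd
Odd-+ (suc zero) _ = inj₁ tt
Odd-+ (suc (suc m)) odd = Odd-+ m odd

Odd-n+1+n : ∀ n → Odd (n + suc n)
Odd-n+1+n zero = tt
Odd-n+1+n (suc n) rewrite +-suc n (suc n) = Odd-n+1+n n

Odd⇒1≤ : ∀ {n} → Odd n → 1 ≤ n
Odd⇒1≤ {suc n} _ = s≤s z≤n

least : ∀ {P : ℕ → Set} → Decidable P → ∀ {n} → P n → ∃ λ d → P d × (∀ {k} → P k → d ≤ k)
least {P} P? {n} Pn = searchFrom 0 n (λ ()) (subst P (sym (+-identityʳ n)) Pn)
  where
  searchFrom : ∀ m f → (∀ {k} → k < m → ¬ P k) → P (f + m) →
               ∃ λ d → P d × (∀ {k} → P k → d ≤ k)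
  searchFrom m f none-below Pf+m with P? m
  ... | yes Pm = m , Pm , λ Pk → ≮⇒≥ λ k<m → none-below k<m Pk
  searchFrom m zero    none-below Pm   | no ¬Pm = ⊥-elim (¬Pm Pm)
  searchFrom m (suc f) none-below Pf+m | no ¬Pm =
    searchFrom (suc m) f none-below′ (subst P (sym (+-suc f m)) Pf+m)
    where
    none-below′ : ∀ {k} → k < suc m → ¬ P k
    none-below′ k<1+m with m≤n⇒m<n∨m≡n (s≤s⁻¹ k<1+m)
    ... | inj₁ k<m = none-below k<m
    ... | inj₂ refl = ¬Pm

Duplicate : {X : Set} → List X → Set
Duplicate xs = ∃ λ as → ∃ λ x → ∃ λ bs → ∃ λ cs → xs ≡ as ++ x ∷ bs ++ x ∷ cs

unique⊎duplicate : {X : Set} → DecidableEquality X → (xs : List X) → Unique xs ⊎ Duplicate xs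
unique⊎duplicate _≟ˣ_ [] = inj₁ []
unique⊎duplicate _≟ˣ_ (x ∷ xs) with _∈?_ _≟ˣ_ x xs
... | yes x∈xs = let (bs , cs , xs≡) = ∈-∃++ x∈xs in inj₂ ([] , x , bs , cs , cong (x ∷_) xs≡)
... | no x∉xs with unique⊎duplicate _≟ˣ_ xs
...   | inj₁ unique = inj₁ (¬Any⇒All¬ xs x∉xs ∷ unique)
...   | inj₂ (as , y , bs , cs , xs≡) = inj₂ (x ∷ as , y , bs , cs , cong (x ∷_) xs≡)

module WalkProperties {nP nA : ℕ} (T : FinStruct nP (Fin nA)) where

  private
    V : Set
    V = Fin (size T)

    len : ∀ {u v} → Walk T u v → ℕ
    len = walkLength T

  infixr 5 _++ʷ_
  _++ʷ_ : ∀ {u v w} → Walk T u v → Walk T v w → Walk T u w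
  [] ++ʷ q = q
  fwd a e p ++ʷ q = fwd a e (p ++ʷ q)
  bwd a e p ++ʷ q = bwd a e (p ++ʷ q)

  length-++ʷ : ∀ {u v w} (p : Walk T u v) (q : Walk T v w) → len (p ++ʷ q) ≡ len p + len q
  length-++ʷ [] q = refl
  length-++ʷ (fwd a e p) q = cong suc (length-++ʷ p q)
  length-++ʷ (bwd a e p) q = cong suc (length-++ʷ p q)

  reverseʷ : ∀ {u v} → Walk T u v → Walk T v u
  reverseʷ [] = []
  reverseʷ (fwd a e p) = reverseʷ p ++ʷ bwd a e []
  reverseʷ (bwd a e p) = reverseʷ p ++ʷ fwd a e []

  length-reverseʷ : ∀ {u v} (p : Walk T u v) → len (reverseʷ p) ≡ len p
  length-reverseʷ [] = refl
  length-reverseʷ (fwd a e p) = trans (length-++ʷ (reverseʷ p) _) (trans (+-comm _ 1) (cong suc (length-reverseʷ p)))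
  length-reverseʷ (bwd a e p) = trans (length-++ʷ (reverseʷ p) _) (trans (+-comm _ 1) (cong suc (length-reverseʷ p)))

  1≤length : ∀ {u v} (p : Walk T u v) {x xs} → walkVerts T p ≡ x ∷ xs → 1 ≤ len p
  1≤length (fwd _ _ _) _ = s≤s z≤n
  1≤length (bwd _ _ _) _ = s≤s z≤n

  splitAtVertex : ∀ {u v} (w : Walk T u v) as {x} rest → walkVerts T w ≡ as ++ x ∷ rest →
    Σ (Walk T u x) λ p → Σ (Walk T x v) λ q →
      walkVerts T p ≡ as × walkVerts T q ≡ x ∷ rest × len w ≡ len p + len q
  splitAtVertex w@(fwd _ _ _) [] rest verts with ∷-injectiveˡ verts
  ... | refl = [] , w , refl , verts , refl
  splitAtVertex w@(bwd _ _ _) [] rest verts with ∷-injectiveˡ verts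
  ... | refl = [] , w , refl , verts , refl
  splitAtVertex (fwd a e w) (y ∷ as) rest verts =
    let (p , q , p-verts , q-verts , len-w) = splitAtVertex w as rest (∷-injectiveʳ verts)
    in fwd a e p , q , cong₂ _∷_ (∷-injectiveˡ verts) p-verts , q-verts , cong suc len-w
  splitAtVertex (bwd a e w) (y ∷ as) rest verts =
    let (p , q , p-verts , q-verts , len-w) = splitAtVertex w as rest (∷-injectiveʳ verts)
    in bwd a e p , q , cong₂ _∷_ (∷-injectiveˡ verts) p-verts , q-verts , cong suc len-w

  data Traversal : Fact T → V → V → Set where
    forward  : ∀ {α y z} → frel T α y z ≡ true → Traversal (α , y , z) y z
    backward : ∀ {α y z} → frel T α y z ≡ true → Traversal (α , y , z) z y

  infixr 5 _◂_
  _◂_ : ∀ {f x y z} → Traversal f x y → Walk T y z → Walk T x z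
  forward e ◂ p = fwd _ e p
  backward e ◂ p = bwd _ e p

  length-◂ : ∀ {f x y z} (t : Traversal f x y) (p : Walk T y z) → len (t ◂ p) ≡ suc (len p)
  length-◂ (forward _) p = refl
  length-◂ (backward _) p = refl

  record FactVisit {u v} (w : Walk T u v) (f : Fact T) (rest : List (Fact T)) : Set where
    field
      {x₁ x₂}     : V
      before      : Walk T u x₁
      traversal   : Traversal f x₁ x₂
      after       : Walk T x₂ v
      facts-after : walkFacts T after ≡ rest
      length-eq   : len w ≡ len before + suc (len after)
  open FactVisit using (before; traversal; after; facts-after; length-eq)

  visitFact : ∀ {u v} (w : Walk T u v) as f rest → walkFacts T w ≡ as ++ f ∷ rest → FactVisit w f rest
  visitFact (fwd α e w) [] f rest facts with ∷-injectiveˡ facts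
  ... | refl = record
    { before = [] ; traversal = forward e ; after = w ; facts-after = ∷-injectiveʳ facts ; length-eq = refl }
  visitFact (bwd α e w) [] f rest facts with ∷-injectiveˡ facts
  ... | refl = record
    { before = [] ; traversal = backward e ; after = w ; facts-after = ∷-injectiveʳ facts ; length-eq = refl }
  visitFact (fwd α e w) (_ ∷ as) f rest facts =
    let visit = visitFact w as f rest (∷-injectiveʳ facts)
    in record
      { before = fwd α e (before visit) ; traversal = traversal visit ; after = after visit
      ; facts-after = facts-after visit ; length-eq = cong suc (length-eq visit) }
  visitFact (bwd α e w) (_ ∷ as) f rest facts =
    let visit = visitFact w as f rest (∷-injectiveʳ facts)
    in record
      { before = bwd α e (before visit) ; traversal = traversal visit ; after = after visit
      ; facts-after = facts-after visit ; length-eq = cong suc (length-eq visit) }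

  record Split {u} (w : Walk T u u) : Set where
    field
      {x y}     : V
      left      : Walk T x x
      right     : Walk T y y
      left<     : len left < len w
      right<    : len right < len w
      odd-parts : Odd (len w) → Odd (len left + len right)
  open Split using (left; right; left<; right<; odd-parts)

  split-sum : ∀ {u x y} {w : Walk T u u} (l : Walk T x x) (r : Walk T y y) →
    1 ≤ len l → 1 ≤ len r → len l + len r ≡ len w → Split w
  split-sum l r 1≤l 1≤r l+r≡w = record
    { left = l ; right = r
    ; left< = subst (len l <_) l+r≡w (m<m+n (len l) 1≤r)
    ; right< = subst (len r <_) l+r≡w (m<n+m (len r) 1≤l)
    ; odd-parts = subst Odd (sym l+r≡w) }

  split-sum+2 : ∀ {u x y} {w : Walk T u u} (l : Walk T x x) (r : Walk T y y) →
    2 + (len l + len r) ≡ len w → Split w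
  split-sum+2 l r 2+l+r≡w = record
    { left = l ; right = r
    ; left< = subst (len l <_) 2+l+r≡w (s≤s (≤-trans (m≤m+n (len l) (len r)) (n≤1+n _)))
    ; right< = subst (len r <_) 2+l+r≡w (s≤s (≤-trans (m≤n+m (len r) (len l)) (n≤1+n _)))
    ; odd-parts = subst Odd (sym 2+l+r≡w) }

  private
    length-++ʷ-◂ : ∀ {f u x y v} (p : Walk T u x) (t : Traversal f x y) (q : Walk T y v) →
      len (p ++ʷ t ◂ q) ≡ len p + suc (len q)
    length-++ʷ-◂ p t q = trans (length-++ʷ p (t ◂ q)) (cong (len p +_) (length-◂ t q))

    1≤m+1+n : ∀ m n → 1 ≤ m + suc n
    1≤m+1+n m n = subst (1 ≤_) (sym (+-suc m n)) (s≤s z≤n)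

  repeatedVertex⇒split : ∀ {u} (w : Walk T u u) → Duplicate (walkVerts T w) → Split w
  repeatedVertex⇒split w (as , x , bs , cs , verts) =
    let (a , r , _ , r-verts , len-w) = splitAtVertex w as (bs ++ x ∷ cs) verts
        (b , c , b-verts , c-verts , len-r) = splitAtVertex r (x ∷ bs) cs r-verts
        open ≡-Reasoning
    in split-sum b (a ++ʷ c) (1≤length b b-verts)
         (subst (1 ≤_) (sym (length-++ʷ a c)) (≤-trans (1≤length c c-verts) (m≤n+m _ (len a))))
         (begin
           len b + len (a ++ʷ c)    ≡⟨ cong (len b +_) (length-++ʷ a c) ⟩
           len b + (len a + len c)  ≡⟨ +-permute (len b) (len a) (len c) ⟩
           len a + (len b + len c)  ≡⟨ cong (len a +_) (sym len-r) ⟩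
           len a + len r            ≡⟨ sym len-w ⟩
           len w                    ∎)
    where
    +-permute : ∀ m n o → m + (n + o) ≡ n + (m + o)
    +-permute = solve-∀

  sameDirection⇒split : ∀ {f u x₁ x₂} {w : Walk T u u}
    (a : Walk T u x₁) (s : Traversal f x₁ x₂) (b : Walk T x₂ x₁) (t : Traversal f x₁ x₂) (c : Walk T x₂ u) →
    len w ≡ len a + suc (len b + suc (len c)) → Split w
  sameDirection⇒split {w = w} a s b t c len-w =
    split-sum (b ++ʷ t ◂ []) (a ++ʷ s ◂ c)
      (subst (1 ≤_) (sym (length-++ʷ-◂ b t [])) (1≤m+1+n (len b) 0))
      (subst (1 ≤_) (sym (length-++ʷ-◂ a s c)) (1≤m+1+n (len a) (len c)))
      (begin
        len (b ++ʷ t ◂ []) + len (a ++ʷ s ◂ c)  ≡⟨ cong₂ _+_ (length-++ʷ-◂ b t []) (length-++ʷ-◂ a s c) ⟩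
        (len b + 1) + (len a + suc (len c))      ≡⟨ rearrange (len a) (len b) (len c) ⟩
        len a + suc (len b + suc (len c))        ≡⟨ sym len-w ⟩
        len w                                    ∎)
    where
    open ≡-Reasoning
    rearrange : ∀ m n o → (n + 1) + (m + suc o) ≡ m + suc (n + suc o)
    rearrange = solve-∀

  oppositeDirection⇒split : ∀ {u x₁ x₂} {w : Walk T u u}
    (a : Walk T u x₁) (b : Walk T x₂ x₂) (c : Walk T x₁ u) →
    len w ≡ len a + suc (len b + suc (len c)) → Split w
  oppositeDirection⇒split {w = w} a b c len-w =
    split-sum+2 b (a ++ʷ c)
      (begin
        2 + (len b + len (a ++ʷ c))        ≡⟨ cong (λ k → 2 + (len b + k)) (length-++ʷ a c) ⟩
        2 + (len b + (len a + len c))      ≡⟨ rearrange (len a) (len b) (len c) ⟩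
        len a + suc (len b + suc (len c))  ≡⟨ sym len-w ⟩
        len w                              ∎)
    where
    open ≡-Reasoning
    rearrange : ∀ m n o → 2 + (n + (m + o)) ≡ m + suc (n + suc o)
    rearrange = solve-∀

  repeatedFact⇒split : ∀ {u} (w : Walk T u u) → Duplicate (walkFacts T w) → Split w
  repeatedFact⇒split w (as , f , bs , cs , facts) =
    let v₁ = visitFact w as f (bs ++ f ∷ cs) facts
        v₂ = visitFact (after v₁) bs f cs (facts-after v₁)
    in byDirection (before v₁) (traversal v₁) (before v₂) (traversal v₂) (after v₂)
         (trans (length-eq v₁) (cong (λ k → len (before v₁) + suc k) (length-eq v₂)))
    where
    byDirection : ∀ {f x₁ x₂ y₁ y₂}
      (a : Walk T _ x₁) (s : Traversal f x₁ x₂) (b : Walk T x₂ y₁) (t : Traversal f y₁ y₂) (c : Walk T y₂ _) →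
      len w ≡ len a + suc (len b + suc (len c)) → Split w
    byDirection a s@(forward _)  b t@(forward _)  c = sameDirection⇒split a s b t c
    byDirection a s@(backward _) b t@(backward _) c = sameDirection⇒split a s b t c
    byDirection a (forward _)  b (backward _) c = oppositeDirection⇒split a b c
    byDirection a (backward _) b (forward _)  c = oppositeDirection⇒split a b c

  cycle⊎split : ∀ {u} (w : Walk T u u) → 1 ≤ len w → Cycle T ⊎ Split w
  cycle⊎split w 1≤len
    with unique⊎duplicate _≟_ (walkVerts T w) | unique⊎duplicate (≡-dec _≟_ (≡-dec _≟_ _≟_)) (walkFacts T w)
  ... | inj₂ repeated | _ = inj₂ (repeatedVertex⇒split w repeated)
  ... | inj₁ _ | inj₂ repeated = inj₂ (repeatedFact⇒split w repeated)
  ... | inj₁ distinct-verts | inj₁ distinct-facts = inj₁ (_ , w , 1≤len , distinct-facts , distinct-verts)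

  oddClosedWalk⇒cycle : ∀ {u} (w : Walk T u u) → Odd (len w) → Cycle T
  oddClosedWalk⇒cycle w = go w (<-wellFounded (len w))
    where
    go : ∀ {u} (w : Walk T u u) → Acc _<_ (len w) → Odd (len w) → Cycle T
    go w (acc shorter) odd with cycle⊎split w (Odd⇒1≤ odd)
    ... | inj₁ cycle = cycle
    ... | inj₂ s with Odd-+ (len (left s)) (odd-parts s odd)
    ...   | inj₁ odd-left = go (left s) (shorter (left< s)) odd-left
    ...   | inj₂ odd-right = go (right s) (shorter (right< s)) odd-right

  walkOfLength? : ∀ k u v → Dec (Σ (Walk T u v) λ p → len p ≡ k)
  walkOfLength? zero u v with u ≟ v
  ... | yes refl = yes ([] , refl)
  ... | no u≢v = no λ { ([] , _) → u≢v refl }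
  walkOfLength? (suc k) u v
    with any? (λ a → any? (λ x → ((frel T a u x Bool.≟ true) ⊎-dec (frel T a x u Bool.≟ true))
                                   ×-dec walkOfLength? k x v))
  ... | yes (a , x , inj₁ e , p , len-p) = yes (fwd a e p , cong suc len-p)
  ... | yes (a , x , inj₂ e , p , len-p) = yes (bwd a e p , cong suc len-p)
  ... | no none = no λ
    { (fwd a e p , len-p) → none (a , _ , inj₁ e , p , suc-injective len-p)
    ; (bwd a e p , len-p) → none (a , _ , inj₂ e , p , suc-injective len-p) }

  depth : Connected T → ∀ v → ∃ (Depth T v)
  depth connected v =
    let (d , shortest , minimal) = least (λ k → walkOfLength? k (froot T) v) (connected v , refl)
    in d , shortest , λ p → minimal (p , refl)

  edge-endpoints-differ-in-depth : InA T → ∀ {i x y} → frel T i x y ≡ true →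
    Shallower T x y ⊎ Shallower T y x
  edge-endpoints-differ-in-depth (connected , acyclic) {i} {x} {y} e
    with depth connected x | depth connected y
  ... | dx , Dx@((p , len-p) , _) | dy , Dy@((q , len-q) , _) with <-cmp dx dy
  ... | tri< dx<dy _ _ = inj₁ (dx , dy , Dx , Dy , dx<dy)
  ... | tri> _ _ dy<dx = inj₂ (dy , dx , Dy , Dx , dy<dx)
  ... | tri≈ _ refl _ = ⊥-elim (acyclic (oddClosedWalk⇒cycle closed (subst Odd (sym len-closed) (Odd-n+1+n dx))))
    where
    closed : Walk T (froot T) (froot T)
    closed = p ++ʷ fwd i e (reverseʷ q)
    len-closed : len closed ≡ dx + suc dx
    len-closed = trans (length-++ʷ p _) (cong₂ (λ m n → m + suc n) len-p (trans (length-reverseʷ q) len-q))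

open WalkProperties using (edge-endpoints-differ-in-depth)

flip-inverse : ∀ {nP nA} {M : Struct nP (Fin nA)} (T : FinStruct nP (σB nA)) →
  Inverse (homSetoid ⟦ T ⟧ (backExp M)) (homSetoid (flip T) M)
flip-inverse {M = M} T = record
  { to = toFlip ; from = fromFlip ; to-cong = id ; from-cong = id ; inverse = id , id }
  where
  toFlip : Hom ⟦ T ⟧ (backExp M) → Hom (flip T) M
  toFlip h = record
    { map = map h ; map-root = map-root h ; map-prop = map-prop h
    ; map-rel = λ { i x y (inj₁ e) → map-rel h (inj₁ i) x y e
                  ; i x y (inj₂ e) → map-rel h (inj₂ i) y x e } }
  fromFlip : Hom (flip T) M → Hom ⟦ T ⟧ (backExp M)
  fromFlip g = record
    { map = map g ; map-root = map-root g ; map-prop = map-prop g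
    ; map-rel = λ { (inj₁ i) x y e → map-rel g i x y (inj₁ e)
                  ; (inj₂ i) x y e → map-rel g i y x (inj₂ e) } }

down-inverse : ∀ {nP nA} {M : Struct nP (Fin nA)} (T : FinStruct nP (Fin nA)) → InA T →
  Inverse (homSetoid ⟦ T ⟧ M) (homSetoid (down T) (backExp M))
down-inverse {M = M} T inA = record
  { to = toDown ; from = fromDown ; to-cong = id ; from-cong = id ; inverse = id , id }
  where
  toDown : Hom ⟦ T ⟧ M → Hom (down T) (backExp M)
  toDown h = record
    { map = map h ; map-root = map-root h ; map-prop = map-prop h
    ; map-rel = λ { (inj₁ i) x y (e , _) → map-rel h i x y e
                  ; (inj₂ i) x y (e , _) → map-rel h i y x e } }
  fromDown : Hom (down T) (backExp M) → Hom ⟦ T ⟧ M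
  fromDown g = record
    { map = map g ; map-root = map-root g ; map-prop = map-prop g ; map-rel = map-rel′ }
    where
    map-rel′ : ∀ i x y → frel T i x y ≡ true → rel M i (map g x) (map g y)
    map-rel′ i x y e with edge-endpoints-differ-in-depth T inA e
    ... | inj₁ x-shallower = map-rel g (inj₁ i) x y (e , x-shallower)
    ... | inj₂ y-shallower = map-rel g (inj₂ i) y x (e , y-shallower)

proposition4p10 : ∀ {nP nA : ℕ} (M : Struct nP (Fin nA)) → DegreeFinite M →
    (∀ (T : FinStruct nP (Fin nA)) → InA T →
       ∀ (n : ℕ) → HomCount ⟦ T ⟧ M n ⇔ HomCount (down T) (backExp M) n)
  × (∀ (T : FinStruct nP (σB nA)) → IsTree T →
       ∀ (n : ℕ) → HomCount ⟦ T ⟧ (backExp M) n ⇔ HomCount (flip T) M n)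
proposition4p10 M _ =
    (λ T inA _ → homCount-⇔ (down-inverse T inA))
  , (λ T _ _ → homCount-⇔ (flip-inverse T))
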